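{- Let $m=2$ and consider the instance $I$ on $2$ machines with three jobs $J_1,J_2,J_3$ arriving in this order, each with $u_j=2$ and $t_j=1$, whose processing times are chosen adaptively by an adversary against a deterministic online algorithm $A$ as follows: exactly two jobs get $p_j=0$ and the other gets $p_j=2$; when $J_j$ is handled, let $z$ be the number of earlier jobs already given $p=0$; if $J_j$ is untested and $z<2$ then $p_j=0$; if $J_j$ is tested, then $p_j=0$ if $z<2$ and $4-j\le 2-z$, and $p_j=2$ otherwise; if $J_j$ is untested and $z=2$ then $p_j=2$. (Equivalently, the first two untested jobs, if they exist, get $p_j=0$, and any remaining zeros go to the last jobs of the sequence.) Then for every deterministic online algorithm $A$, either $C^A(I)\ge5$, or $C^A(I)\ge4$ and $C^A_{\min}(I)\ge1$, or $C^A(I)\ge3$ and $C^A_{\min}(I)\ge2$, where $C^A(I)$ and $C^A_{\min}(I)$ are the maximum and minimum machine load in the schedule produced by $A$.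
   Context: Online scheduling with testing on $m$ identical machines: jobs arrive one by one; on arrival of $J_j$ its $u_j,t_j$ are revealed and the algorithm irrevocably decides whether to test $J_j$ and which machine processes it. An untested job adds $u_j$ to its machine's load; a tested job adds $t_j+p_j$, and $p_j$ is revealed to the algorithm after testing. The load of a machine is the total time of the jobs assigned to it. -}

module Defs where

open import Data.Nat using (ℕ; zero; suc; _+_; _∸_; _<ᵇ_; _≤ᵇ_; _⊔_; _⊓_)
open import Data.Bool using (Bool; true; false; if_then_else_; _∧_)
open import Data.Fin using (Fin; zero; suc)
open import Data.Maybe using (Maybe; just; nothing)
open import Data.List using (List; []; _∷_; _++_; [_])
open import Data.Product using (_×_; _,_)

u t : ℕ
u = 2
t = 1

-- A decision for a job: (test it?, machine it is assigned to).
Decision : Set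
Decision = Bool × Fin 2

-- What the algorithm learns about a handled job: its decision and,
-- if tested, the revealed processing time p_j (nothing if untested).
Observation : Set
Observation = Decision × Maybe ℕ

-- A deterministic online algorithm: its decision for the next job is a
-- function of the history of previously handled jobs (in arrival order).
-- (u_j, t_j are constants of the instance, and the index j is
-- length of the history, so no further input is needed.)
Algorithm : Set
Algorithm = List Observation → Decision

adversaryP : (j z : ℕ) → Bool → ℕ
adversaryP j z false = if z <ᵇ 2 then 0 else 2
adversaryP j z true  = if (z <ᵇ 2) ∧ ((4 ∸ j) ≤ᵇ (2 ∸ z)) then 0 else 2

jobTime : Bool → ℕ → ℕ
jobTime false p = u
jobTime true  p = t + p

record State : Set where
  constructor state
  field
    history : List Observation
    zeros   : ℕ
    load₀   : ℕ
    load₁   : ℕ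
open State public

initState : State
initState = state [] 0 0 0

addLoad : Fin 2 → ℕ → State → ℕ × ℕ
addLoad zero    x s = (load₀ s + x , load₁ s)
addLoad (suc _) x s = (load₀ s , load₁ s + x)

isZero : ℕ → ℕ
isZero zero    = 1
isZero (suc _) = 0

step : Algorithm → ℕ → State → State
step A j s with A (history s)
... | (b , i) with adversaryP j (zeros s) b
...   | p with addLoad i (jobTime b p) s
...     | (l₀ , l₁) =
  state (history s ++ [ ((b , i) , (if b then just p else nothing)) ])
        (zeros s + isZero p) l₀ l₁

finalState : Algorithm → State
finalState A = step A 3 (step A 2 (step A 1 initState))

Cmax : Algorithm → ℕ
Cmax A = load₀ (finalState A) ⊔ load₁ (finalState A)

Cmin : Algorithm → ℕ
Cmin A = load₀ (finalState A) ⊓ load₁ (finalState A)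

-- Every job raises (total load + number of zeros handed out) by at least 2: an untested
-- job costs u = 2, a tested one costs 1 + p and p = 0 also counts as a zero.  The first
-- job raises it by 3, since a test at J₁ always reveals p = 2.  So this quantity ends at
-- least at 7, while the adversary never hands out more than 2 zeros; hence the two loads
-- sum to at least 5, and any two loads summing to 5 or more satisfy the disjunction.
module Submission where

open import Defs
open import Data.Bool using (Bool; true; false)
open import Data.Fin using (zero; suc)
open import Data.Nat using (ℕ; zero; suc; _+_; _⊔_; _⊓_; _≤_; _≥_; z≤n; s≤s)
open import Data.Nat.Properties
  using (1+n≰n; ≤-refl; ≤-trans; +-assoc; +-identityʳ; +-suc; +-cancelˡ-≤; +-cancelʳ-≤;
         +-monoʳ-≤; +-monoˡ-≤; +-mono-≤; m⊓n≤m⊔n; +-commutativeSemigroup)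
open import Data.Product using (_×_; _,_; proj₁; proj₂)
open import Data.Sum using (_⊎_; inj₁; inj₂)
open import Relation.Nullary using (¬_; contradiction)
open import Relation.Binary.PropositionalEquality
  using (_≡_; refl; cong; sym; subst; module ≡-Reasoning)
open import Algebra.Properties.CommutativeSemigroup +-commutativeSemigroup
  using (interchange; xy∙z≈xz∙y)

totalLoad : State → ℕ
totalLoad s = load₀ s + load₁ s

potential : State → ℕ
potential s = totalLoad s + zeros s

gain : (j z : ℕ) → Bool → ℕ
gain j z b = jobTime b p + isZero p
  where
    p : ℕ
    p = adversaryP j z b

addLoad-total : ∀ i x s → proj₁ (addLoad i x s) + proj₂ (addLoad i x s) ≡ totalLoad s + x
addLoad-total zero    x s = xy∙z≈xz∙y (load₀ s) x (load₁ s)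
addLoad-total (suc _) x s = sym (+-assoc (load₀ s) (load₁ s) x)

step-potential : ∀ A j s →
  potential (step A j s) ≡ potential s + gain j (zeros s) (proj₁ (A (history s)))
step-potential A j s with A (history s)
... | (b , i) =
  subst (λ l → l + (zeros s + k) ≡ totalLoad s + zeros s + (x + k))
        (sym (addLoad-total i x s))
        (interchange (totalLoad s) x (zeros s) k)
  where
    p x k : ℕ
    p = adversaryP j (zeros s) b
    x = jobTime b p
    k = isZero p

jobTime+isZero≥2 : ∀ b p → 2 ≤ jobTime b p + isZero p
jobTime+isZero≥2 false p       = s≤s (s≤s z≤n)
jobTime+isZero≥2 true  zero    = ≤-refl
jobTime+isZero≥2 true  (suc p) = s≤s (s≤s z≤n)

gain≥2 : ∀ j z b → 2 ≤ gain j z b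
gain≥2 j z b = jobTime+isZero≥2 b (adversaryP j z b)

gain-first≥3 : ∀ b → 3 ≤ gain 1 0 b
gain-first≥3 false = ≤-refl
gain-first≥3 true  = ≤-refl

step-potential-≥ : ∀ {k} A j s → (∀ b → k ≤ gain j (zeros s) b) →
  potential s + k ≤ potential (step A j s)
step-potential-≥ {k} A j s gain≥k =
  subst (potential s + k ≤_) (sym (step-potential A j s))
        (+-monoʳ-≤ (potential s) (gain≥k (proj₁ (A (history s)))))

step-potential-+2 : ∀ {w} A j s → w ≤ potential s → w + 2 ≤ potential (step A j s)
step-potential-+2 A j s w≤ = ≤-trans (+-monoˡ-≤ 2 w≤) (step-potential-≥ A j s (gain≥2 j (zeros s)))

isZero≤1 : ∀ p → isZero p ≤ 1
isZero≤1 zero    = ≤-refl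
isZero≤1 (suc _) = z≤n

-- once two zeros have been handed out, the adversary answers p = 2 whatever the decision
adversary-zeros≤2 : ∀ j z b → z ≤ 2 → z + isZero (adversaryP j z b) ≤ 2
adversary-zeros≤2 j 0 b _ = ≤-trans (isZero≤1 (adversaryP j 0 b)) (s≤s z≤n)
adversary-zeros≤2 j 1 b _ = s≤s (isZero≤1 (adversaryP j 1 b))
adversary-zeros≤2 j 2 false _ = ≤-refl
adversary-zeros≤2 j 2 true  _ = ≤-refl
adversary-zeros≤2 j (suc (suc (suc _))) b (s≤s (s≤s ()))

step-zeros≤2 : ∀ A j s → zeros s ≤ 2 → zeros (step A j s) ≤ 2
step-zeros≤2 A j s z≤2 with A (history s)
... | (b , i) = adversary-zeros≤2 j (zeros s) b z≤2

finalState-totalLoad≥5 : ∀ A → 5 ≤ totalLoad (finalState A)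
finalState-totalLoad≥5 A =
  +-cancelʳ-≤ 2 5 (totalLoad s₃)
    (≤-trans potential≥7 (+-monoʳ-≤ (totalLoad s₃) zeros≤2))
  where
    s₁ s₂ s₃ : State
    s₁ = step A 1 initState
    s₂ = step A 2 s₁
    s₃ = step A 3 s₂
    potential≥7 : 7 ≤ potential s₃
    potential≥7 =
      step-potential-+2 A 3 s₂ (step-potential-+2 A 2 s₁ (step-potential-≥ A 1 initState gain-first≥3))
    zeros≤2 : zeros s₃ ≤ 2
    zeros≤2 = step-zeros≤2 A 3 s₂ (step-zeros≤2 A 2 s₁ (step-zeros≤2 A 1 initState z≤n))

⊔+⊓≡+ : ∀ m n → m ⊔ n + m ⊓ n ≡ m + n
⊔+⊓≡+ zero    n       = +-identityʳ n
⊔+⊓≡+ (suc m) zero    = refl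
⊔+⊓≡+ (suc m) (suc n) = cong suc (begin
  m ⊔ n + suc (m ⊓ n)  ≡⟨ +-suc (m ⊔ n) (m ⊓ n) ⟩
  suc (m ⊔ n + m ⊓ n)  ≡⟨ cong suc (⊔+⊓≡+ m n) ⟩
  suc (m + n)          ≡⟨ +-suc m n ⟨
  m + suc n            ∎)
  where open ≡-Reasoning

small-loads-sum≱5 : ∀ {M m} → M ≤ 2 → m ≤ M → ¬ 5 ≤ M + m
small-loads-sum≱5 M≤2 m≤M 5≤ = 1+n≰n (≤-trans 5≤ (+-mono-≤ M≤2 (≤-trans m≤M M≤2)))

loads-bound : ∀ {M m} → m ≤ M → 5 ≤ M + m →
  (M ≥ 5) ⊎ ((M ≥ 4 × m ≥ 1) ⊎ (M ≥ 3 × m ≥ 2))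
loads-bound {suc (suc (suc (suc (suc _))))} _ _ = inj₁ (s≤s (s≤s (s≤s (s≤s (s≤s z≤n)))))
loads-bound {4} {m} _ 5≤ = inj₂ (inj₁ (≤-refl , +-cancelˡ-≤ 4 1 m 5≤))
loads-bound {3} {m} _ 5≤ = inj₂ (inj₂ (≤-refl , +-cancelˡ-≤ 3 2 m 5≤))
loads-bound {2} m≤M 5≤ = contradiction 5≤ (small-loads-sum≱5 ≤-refl m≤M)
loads-bound {1} m≤M 5≤ = contradiction 5≤ (small-loads-sum≱5 (s≤s z≤n) m≤M)
loads-bound {0} m≤M 5≤ = contradiction 5≤ (small-loads-sum≱5 z≤n m≤M)

lemma10 : (A : Algorithm) →
    (Cmax A ≥ 5) ⊎ ((Cmax A ≥ 4 × Cmin A ≥ 1) ⊎ (Cmax A ≥ 3 × Cmin A ≥ 2))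
lemma10 A =
  loads-bound (m⊓n≤m⊔n l₀ l₁) (subst (5 ≤_) (sym (⊔+⊓≡+ l₀ l₁)) (finalState-totalLoad≥5 A))
  where
    l₀ l₁ : ℕ
    l₀ = load₀ (finalState A)
    l₁ = load₁ (finalState A)
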